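{- Let $m\ge0$ be even. The sum of the pivots over all self twin parsimonious games with $m+4$ players whose free type representation has an odd number of components (each game counted once) equals $3\cdot 2^{m/2}$.
   Context: Parsimonious (P) games: constant-sum homogeneous weighted majority games on $n$ players, without dummies and without dictator, having exactly $n$ minimal winning coalitions (homogeneous: weights $\mathbf w$, quota $q$, $S$ winning iff $\sum_{i\in S}w_i\ge q$, with equality for every minimal winning $S$). Each has a unique minimal homogeneous representation with integer weights $1=w_1\le\dots\le w_n$. Binary representation: $\mathbf b\in\{0,1\}^n$, $b_1=1$, $b_i=1$ iff $w_i>w_{i-1}$. Known: $b_1=1,b_2=0,b_{n-1}=0,b_n=1$ always, and $(b_3,\dots,b_{n-2})$ determines the game, every vector in $\{0,1\}^{n-4}$ arising. The number of types $h$ is the number of distinct weights; the type representation is $(x_1,\dots,x_h)$, $x_t$ the number of players with the $t$-th smallest distinct weight; the free type representation is $(x_1,\dots,x_{h-1})$. A P game is self twin if $b_i=b_{n+1-i}$ for $i=3,\dots,n-2$. When $h-1$ is odd, the middle component $x_{h/2}$ is called the pivot. -}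

module Defs where

open import Data.Bool using (Bool; true; false)
open import Data.Bool.Properties using () renaming (_≟_ to _≟ᵇ_)
open import Data.Nat using (ℕ; zero; suc; _+_; _∸_; _/_; _%_)
open import Data.Nat.Properties using () renaming (_≟_ to _≟ℕ_)
open import Data.List using (List; []; _∷_; _++_; length; map; filter; concatMap)
open import Data.Nat.ListAction using (sum)
open import Data.Vec using (Vec; []; _∷_; toList; reverse)
open import Data.Vec.Properties using (≡-dec)
open import Data.Product using (_×_; _,_; proj₁; proj₂)
open import Relation.Binary.PropositionalEquality using (_≡_)
open import Relation.Nullary using (Dec)

-- A parsimonious game on n = m + 4 players is determined by (and
-- determines) the free part (b_3,...,b_{n-2}) ∈ {0,1}^m of its binary
-- representation, every vector arising.  We index P games on m + 4
-- players by c : Vec Bool m (true = 1).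
PGame : ℕ → Set
PGame m = Vec Bool m

allPGames : (m : ℕ) → List (PGame m)
allPGames zero    = [] ∷ []
allPGames (suc m) = concatMap (λ c → (false ∷ c) ∷ (true ∷ c) ∷ []) (allPGames m)

binaryRep : {m : ℕ} → PGame m → List Bool
binaryRep c = true ∷ false ∷ (toList c ++ (false ∷ true ∷ []))

-- aux bs = (number of leading 0s of bs , type representation of the rest)
aux : List Bool → ℕ × List ℕ
aux []           = 0 , []
aux (false ∷ bs) = suc (proj₁ (aux bs)) , proj₂ (aux bs)
aux (true  ∷ bs) = 0 , (suc (proj₁ (aux bs)) ∷ proj₂ (aux bs))

-- Type representation (x_1, ..., x_h): x_t = number of players with the
-- t-th smallest weight = length of the t-th block starting at a 1 of b.
typeRep : {m : ℕ} → PGame m → List ℕ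
typeRep c = proj₂ (aux (binaryRep c))

numTypes : {m : ℕ} → PGame m → ℕ
numTypes c = length (typeRep c)

dropLast : List ℕ → List ℕ
dropLast []           = []
dropLast (x ∷ [])     = []
dropLast (x ∷ y ∷ xs) = x ∷ dropLast (y ∷ xs)

freeTypeRep : {m : ℕ} → PGame m → List ℕ
freeTypeRep c = dropLast (typeRep c)

-- 1-based indexing into a list (0 outside range)
nth : List ℕ → ℕ → ℕ
nth []       _       = 0
nth (x ∷ xs) (suc zero) = x
nth (x ∷ xs) (suc (suc k)) = nth xs (suc k)
nth (x ∷ xs) zero    = 0

pivot : {m : ℕ} → PGame m → ℕ
pivot c = nth (typeRep c) (numTypes c / 2)

-- self twin: b_i = b_{n+1-i} for i = 3..n-2, i.e. the free part is a palindrome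
SelfTwin : {m : ℕ} → PGame m → Set
SelfTwin c = reverse c ≡ c

selfTwin? : {m : ℕ} (c : PGame m) → Dec (SelfTwin c)
selfTwin? c = ≡-dec _≟ᵇ_ (reverse c) c

OddFree : {m : ℕ} → PGame m → Set
OddFree c = length (freeTypeRep c) % 2 ≡ 1

oddFree? : {m : ℕ} (c : PGame m) → Dec (OddFree c)
oddFree? c = (length (freeTypeRep c) % 2) ≟ℕ 1

pivotSum : ℕ → ℕ
pivotSum m = sum (map pivot (filter oddFree? (filter selfTwin? (allPGames m))))

-- A self twin game on 2k + 4 players is reverse y ++ y with y ∈ {0,1}ᵏ; with R = y 0 1 its
-- binary representation 1 0 (reverse y) y 0 1 is reverse R ++ R.  Writing R = 0ᵗ 1 B, this is
-- reverse B, 1 0²ᵗ, 1 B, so the type representation lists the block lengths of reverse B, then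
-- 2t + 1, then the block lengths of 1 B, which are one more in number.  Hence h is even, the
-- free type representation has odd length and the pivot is 2t + 1.  As a function of y this
-- is 1 on 1y′ and 2 plus its value at y′ on 0y′, so the sum over {0,1}ᵏ⁺¹ is the sum over
-- {0,1}ᵏ plus 3 · 2ᵏ, giving 3 · 2ᵏ by induction from the value 3 at the empty word.

{-# OPTIONS --safe #-}
module Submission where

open import Defs
open import Data.Nat using (ℕ; _*_; _^_; _/_; _%_)
open import Relation.Binary.PropositionalEquality using (_≡_)

open import Data.Bool using (Bool; true; false; if_then_else_; T?)
open import Data.List as List
  using (List; []; _∷_; _++_; _ʳ++_; length; replicate; filter; concatMap)
open import Data.List.Properties using (++-assoc; ++-ʳ++; ʳ++-defn; length-++)
open import Data.List.Relation.Binary.Permutation.Propositional.Properties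
  using (↭-length; ↭-reverse; filter-↭)
open import Data.Nat using (zero; suc; _+_; _∸_)
open import Data.Nat.DivMod using (m≡m%n+[m/n]*n; [m+kn]%n≡m%n; m*n/n≡m)
open import Data.Nat.ListAction using (sum)
open import Data.Nat.Properties
  using (+-comm; +-assoc; +-suc; +-identityʳ; *-identityʳ; +-commutativeSemigroup)
open import Algebra.Properties.CommutativeSemigroup +-commutativeSemigroup using (interchange)
open import Data.Nat.Tactic.RingSolver using (solve-∀)
open import Data.Product using (∃-syntax; _×_; _,_; proj₁; proj₂)
open import Data.Vec as Vec using (Vec; toList)
open import Data.Vec.Properties
  using (∷-injectiveʳ; toList-++; toList-reverse; reverse-involutive; ++-injectiveˡ;
         reverse-++-eqFree; cast-is-id)
open import Function using (_∘_)
open import Relation.Binary.PropositionalEquality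
  using (refl; sym; trans; cong; cong₂; subst; subst₂; _≢_; module ≡-Reasoning)
open import Relation.Nullary using (does; ¬_)
open import Relation.Nullary.Decidable using (dec-true; dec-false)
open import Relation.Unary using (Pred; Decidable)

open ≡-Reasoning

sumVecs : (m : ℕ) → (Vec Bool m → ℕ) → ℕ
sumVecs zero    f = f Vec.[]
sumVecs (suc m) f = sumVecs m (λ c → f (false Vec.∷ c) + f (true Vec.∷ c))

sumVecs-cong : ∀ m {f g : Vec Bool m → ℕ} → (∀ c → f c ≡ g c) →
               sumVecs m f ≡ sumVecs m g
sumVecs-cong zero    f≗g = f≗g Vec.[]
sumVecs-cong (suc m) f≗g = sumVecs-cong m (λ c → cong₂ _+_ (f≗g _) (f≗g _))

sumVecs-+ : ∀ m (f g : Vec Bool m → ℕ) →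
            sumVecs m (λ c → f c + g c) ≡ sumVecs m f + sumVecs m g
sumVecs-+ zero    f g = refl
sumVecs-+ (suc m) f g =
  trans (sumVecs-cong m (λ c → interchange (f (false Vec.∷ c)) (g (false Vec.∷ c)) _ _))
        (sumVecs-+ m _ _)

sumVecs-const : ∀ m n → sumVecs m (λ _ → n) ≡ n * 2 ^ m
sumVecs-const zero    n = sym (*-identityʳ n)
sumVecs-const (suc m) n = trans (sumVecs-const m (n + n)) (doubling n (2 ^ m))
  where
  doubling : ∀ n z → (n + n) * z ≡ n * (2 * z)
  doubling = solve-∀

sumVecs-++ : ∀ a b (f : Vec Bool (a + b) → ℕ) →
             sumVecs (a + b) f ≡ sumVecs a (λ x → sumVecs b (λ y → f (x Vec.++ y)))
sumVecs-++ zero    b f = refl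
sumVecs-++ (suc a) b f =
  trans (sumVecs-++ a b _) (sumVecs-cong a (λ x → sumVecs-+ b _ _))

sumVecs-swap : ∀ a b (f : Vec Bool a → Vec Bool b → ℕ) →
               sumVecs a (λ x → sumVecs b (f x))
               ≡ sumVecs b (λ y → sumVecs a (λ x → f x y))
sumVecs-swap zero    b f = refl
sumVecs-swap (suc a) b f =
  trans (sumVecs-cong a (λ x → sym (sumVecs-+ b _ _))) (sumVecs-swap a b _)

sumVecs-vanish : ∀ m {f : Vec Bool m → ℕ} → (∀ c → f c ≡ 0) → sumVecs m f ≡ 0
sumVecs-vanish m f≡0 = trans (sumVecs-cong m f≡0) (sumVecs-const m 0)

sumVecs-single : ∀ m (v : Vec Bool m) (f : Vec Bool m → ℕ) →
                 (∀ c → c ≢ v → f c ≡ 0) → sumVecs m f ≡ f v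
sumVecs-single zero    Vec.[]          f f≡0 = refl
sumVecs-single (suc m) (false Vec.∷ v) f f≡0 =
  trans (sumVecs-+ m _ _)
        (trans (cong₂ _+_ (sumVecs-single m v _ (λ c c≢v → f≡0 _ (c≢v ∘ ∷-injectiveʳ)))
                          (sumVecs-vanish m (λ c → f≡0 _ λ ())))
               (+-identityʳ _))
sumVecs-single (suc m) (true Vec.∷ v)  f f≡0 =
  trans (sumVecs-+ m _ _)
        (cong₂ _+_ (sumVecs-vanish m (λ c → f≡0 _ λ ()))
                   (sumVecs-single m v _ (λ c c≢v → f≡0 _ (c≢v ∘ ∷-injectiveʳ))))

sum-map-allPGames : ∀ m (f : PGame m → ℕ) → sum (List.map f (allPGames m)) ≡ sumVecs m f
sum-map-allPGames zero    f = +-identityʳ (f Vec.[])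
sum-map-allPGames (suc m) f = trans (sum-map-doubled (allPGames m)) (sum-map-allPGames m _)
  where
  sum-map-doubled : ∀ cs →
    sum (List.map f (concatMap (λ c → (false Vec.∷ c) ∷ (true Vec.∷ c) ∷ []) cs))
    ≡ sum (List.map (λ c → f (false Vec.∷ c) + f (true Vec.∷ c)) cs)
  sum-map-doubled []       = refl
  sum-map-doubled (c ∷ cs) =
    trans (cong (f (false Vec.∷ c) +_) (cong (f (true Vec.∷ c) +_) (sum-map-doubled cs)))
          (sym (+-assoc (f (false Vec.∷ c)) _ _))

restrict : ∀ {a p} {A : Set a} {P : Pred A p} → Decidable P → (A → ℕ) → A → ℕ
restrict P? f x = if does (P? x) then f x else 0

module _ {a p} {A : Set a} {P : Pred A p} (P? : Decidable P) (f : A → ℕ) where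

  sum-map-filter : ∀ xs → sum (List.map f (filter P? xs)) ≡ sum (List.map (restrict P? f) xs)
  sum-map-filter []       = refl
  sum-map-filter (x ∷ xs) with does (P? x)
  ... | true  = cong (f x +_) (sum-map-filter xs)
  ... | false = sum-map-filter xs

  restrict-accept : ∀ x → P x → restrict P? f x ≡ f x
  restrict-accept x px rewrite dec-true (P? x) px = refl

  restrict-reject : ∀ x → ¬ P x → restrict P? f x ≡ 0
  restrict-reject x ¬px rewrite dec-false (P? x) ¬px = refl

leadingFalses : List Bool → ℕ
leadingFalses bs = proj₁ (aux bs)

blockLengths : List Bool → List ℕ
blockLengths bs = proj₂ (aux bs)

leadingFalses-++-true : ∀ A R → leadingFalses (A ++ true ∷ R) ≡ leadingFalses A
leadingFalses-++-true []          R = refl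
leadingFalses-++-true (true ∷ A)  R = refl
leadingFalses-++-true (false ∷ A) R = cong suc (leadingFalses-++-true A R)

blockLengths-++-true : ∀ A R →
  blockLengths (A ++ true ∷ R) ≡ blockLengths A ++ blockLengths (true ∷ R)
blockLengths-++-true []          R = refl
blockLengths-++-true (true ∷ A)  R =
  cong₂ _∷_ (cong suc (leadingFalses-++-true A R)) (blockLengths-++-true A R)
blockLengths-++-true (false ∷ A) R = blockLengths-++-true A R

leadingFalses-replicate : ∀ n R → leadingFalses (replicate n false ++ R) ≡ n + leadingFalses R
leadingFalses-replicate zero    R = refl
leadingFalses-replicate (suc n) R = cong suc (leadingFalses-replicate n R)

blockLengths-replicate : ∀ n R → blockLengths (replicate n false ++ R) ≡ blockLengths R
blockLengths-replicate zero    R = refl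
blockLengths-replicate (suc n) R = blockLengths-replicate n R

blockLengths-block : ∀ n R →
  blockLengths (true ∷ replicate n false ++ true ∷ R) ≡ suc n ∷ blockLengths (true ∷ R)
blockLengths-block n R =
  cong₂ _∷_ (cong suc (trans (leadingFalses-replicate n (true ∷ R)) (+-identityʳ n)))
            (blockLengths-replicate n (true ∷ R))

length-blockLengths : ∀ bs → length (blockLengths bs) ≡ length (filter T? bs)
length-blockLengths []           = refl
length-blockLengths (true ∷ bs)  = cong suc (length-blockLengths bs)
length-blockLengths (false ∷ bs) = length-blockLengths bs

replicate-++ : ∀ {a} {A : Set a} m n (x : A) →
               replicate m x ++ replicate n x ≡ replicate (m + n) x
replicate-++ zero    n x = refl
replicate-++ (suc m) n x = cong (x ∷_) (replicate-++ m n x)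

ʳ++-replicate : ∀ {a} {A : Set a} n (x : A) ys → replicate n x ʳ++ ys ≡ replicate n x ++ ys
ʳ++-replicate zero    x ys = refl
ʳ++-replicate (suc n) x ys = begin
  replicate n x ʳ++ x ∷ ys               ≡⟨ ʳ++-replicate n x (x ∷ ys) ⟩
  replicate n x ++ replicate 1 x ++ ys   ≡⟨ ++-assoc (replicate n x) (replicate 1 x) ys ⟨
  (replicate n x ++ replicate 1 x) ++ ys ≡⟨ cong (_++ ys) (replicate-++ n 1 x) ⟩
  replicate (n + 1) x ++ ys              ≡⟨ cong (λ k → replicate k x ++ ys) (+-comm n 1) ⟩
  replicate (suc n) x ++ ys              ∎

mirror-split : ∀ t B → let R = replicate t false ++ true ∷ B in
  R ʳ++ R ≡ List.reverse B ++ true ∷ replicate (t + t) false ++ true ∷ B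
mirror-split t B = begin
  (Z ++ true ∷ B) ʳ++ (Z ++ true ∷ B)
    ≡⟨ ++-ʳ++ Z ⟩
  B ʳ++ true ∷ Z ʳ++ (Z ++ true ∷ B)
    ≡⟨ ʳ++-defn B ⟩
  List.reverse B ++ true ∷ Z ʳ++ (Z ++ true ∷ B)
    ≡⟨ cong (λ w → List.reverse B ++ true ∷ w) middle ⟩
  List.reverse B ++ true ∷ replicate (t + t) false ++ true ∷ B ∎
  where
  Z = replicate t false
  middle : Z ʳ++ (Z ++ true ∷ B) ≡ replicate (t + t) false ++ true ∷ B
  middle = begin
    Z ʳ++ (Z ++ true ∷ B)    ≡⟨ ʳ++-replicate t false _ ⟩
    Z ++ Z ++ true ∷ B       ≡⟨ ++-assoc Z Z _ ⟨
    (Z ++ Z) ++ true ∷ B     ≡⟨ cong (_++ true ∷ B) (replicate-++ t t false) ⟩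
    replicate (t + t) false ++ true ∷ B ∎

blockLengths-mirror : ∀ t B → let R = replicate t false ++ true ∷ B in
  blockLengths (R ʳ++ R)
  ≡ blockLengths (List.reverse B) ++ suc (t + t) ∷ blockLengths (true ∷ B)
blockLengths-mirror t B = begin
  blockLengths (R ʳ++ R)
    ≡⟨ cong blockLengths (mirror-split t B) ⟩
  blockLengths (List.reverse B ++ true ∷ replicate (t + t) false ++ true ∷ B)
    ≡⟨ blockLengths-++-true (List.reverse B) _ ⟩
  blockLengths (List.reverse B) ++ blockLengths (true ∷ replicate (t + t) false ++ true ∷ B)
    ≡⟨ cong (blockLengths (List.reverse B) ++_) (blockLengths-block (t + t) B) ⟩
  blockLengths (List.reverse B) ++ suc (t + t) ∷ blockLengths (true ∷ B) ∎
  where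
  R = replicate t false ++ true ∷ B

-- T has even length h and x is its (h/2)-th entry, counting from 1.
data Centred (x : ℕ) : List ℕ → Set where
  centred : ∀ A B → length B ≡ suc (length A) → Centred x (A ++ x ∷ B)

length-dropLast : ∀ xs → length (dropLast xs) ≡ length xs ∸ 1
length-dropLast []           = refl
length-dropLast (x ∷ [])     = refl
length-dropLast (x ∷ y ∷ xs) = cong suc (length-dropLast (y ∷ xs))

nth-++-∷ : ∀ A x B → nth (A ++ x ∷ B) (suc (length A)) ≡ x
nth-++-∷ []      x B = refl
nth-++-∷ (_ ∷ A) x B = nth-++-∷ A x B

length-centred : ∀ (A : List ℕ) x B → length B ≡ suc (length A) →
                 length (A ++ x ∷ B) ≡ suc (length A) * 2
length-centred A x B |B|≡1+|A| = begin
  length (A ++ x ∷ B)             ≡⟨ length-++ A ⟩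
  length A + suc (length B)       ≡⟨ cong (λ n → length A + suc n) |B|≡1+|A| ⟩
  length A + suc (suc (length A)) ≡⟨ twice-suc (length A) ⟩
  suc (length A) * 2              ∎
  where
  twice-suc : ∀ a → a + suc (suc a) ≡ suc a * 2
  twice-suc = solve-∀

centred-dropLast-odd : ∀ {x T} → Centred x T → length (dropLast T) % 2 ≡ 1
centred-dropLast-odd {x} (centred A B |B|≡1+|A|) = begin
  length (dropLast (A ++ x ∷ B)) % 2
    ≡⟨ cong (_% 2) (length-dropLast (A ++ x ∷ B)) ⟩
  (length (A ++ x ∷ B) ∸ 1) % 2
    ≡⟨ cong (λ n → (n ∸ 1) % 2) (length-centred A x B |B|≡1+|A|) ⟩
  (1 + length A * 2) % 2
    ≡⟨ [m+kn]%n≡m%n 1 (length A) 2 ⟩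
  1 ∎

centred-nth-half : ∀ {x T} → Centred x T → nth T (length T / 2) ≡ x
centred-nth-half {x} (centred A B |B|≡1+|A|) = begin
  nth (A ++ x ∷ B) (length (A ++ x ∷ B) / 2)
    ≡⟨ cong (λ n → nth (A ++ x ∷ B) (n / 2)) (length-centred A x B |B|≡1+|A|) ⟩
  nth (A ++ x ∷ B) (suc (length A) * 2 / 2)
    ≡⟨ cong (nth (A ++ x ∷ B)) (m*n/n≡m (suc (length A)) 2) ⟩
  nth (A ++ x ∷ B) (suc (length A))
    ≡⟨ nth-++-∷ A x B ⟩
  x ∎

centred-mirror : ∀ t B → let R = replicate t false ++ true ∷ B in
                 Centred (suc (t + t)) (blockLengths (R ʳ++ R))
centred-mirror t B =
  subst (Centred (suc (t + t))) (sym (blockLengths-mirror t B))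
        (centred (blockLengths (List.reverse B)) (blockLengths (true ∷ B))
                 (cong suc count-reverse))
  where
  count-reverse : length (blockLengths B) ≡ length (blockLengths (List.reverse B))
  count-reverse = begin
    length (blockLengths B)                   ≡⟨ length-blockLengths B ⟩
    length (filter T? B)                      ≡⟨ ↭-length (filter-↭ T? (↭-reverse B)) ⟨
    length (filter T? (List.reverse B))       ≡⟨ length-blockLengths (List.reverse B) ⟨
    length (blockLengths (List.reverse B))    ∎

centralBlock : List Bool → ℕ
centralBlock []          = 3
centralBlock (true ∷ y)  = 1
centralBlock (false ∷ y) = 2 + centralBlock y

centralBlock-decomposition : ∀ y → ∃[ t ] ∃[ B ]
  (y ++ false ∷ true ∷ [] ≡ replicate t false ++ true ∷ B) × centralBlock y ≡ suc (t + t)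
centralBlock-decomposition []          = 1 , [] , refl , refl
centralBlock-decomposition (true ∷ y)  = 0 , y ++ false ∷ true ∷ [] , refl , refl
centralBlock-decomposition (false ∷ y) with centralBlock-decomposition y
... | t , B , split , block =
  suc t , B , cong (false ∷_) split , cong (2 +_) (trans block (sym (+-suc t t)))

sumVecs-centralBlock : ∀ k → sumVecs k (centralBlock ∘ toList) ≡ 3 * 2 ^ k
sumVecs-centralBlock zero    = refl
sumVecs-centralBlock (suc k) = begin
  sumVecs k (λ y → (2 + centralBlock (toList y)) + 1)
    ≡⟨ sumVecs-cong k (λ y → +-comm (2 + centralBlock (toList y)) 1) ⟩
  sumVecs k (λ y → 3 + centralBlock (toList y))
    ≡⟨ sumVecs-+ k (λ _ → 3) (centralBlock ∘ toList) ⟩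
  sumVecs k (λ _ → 3) + sumVecs k (centralBlock ∘ toList)
    ≡⟨ cong₂ _+_ (sumVecs-const k 3) (sumVecs-centralBlock k) ⟩
  3 * 2 ^ k + 3 * 2 ^ k
    ≡⟨ doubling (2 ^ k) ⟩
  3 * 2 ^ suc k ∎
  where
  doubling : ∀ z → 3 * z + 3 * z ≡ 3 * (2 * z)
  doubling = solve-∀

binaryRep-mirror : ∀ {k} (y : Vec Bool k) → let R = toList y ++ false ∷ true ∷ [] in
                   binaryRep (Vec.reverse y Vec.++ y) ≡ R ʳ++ R
binaryRep-mirror y = trans (cong (λ w → true ∷ false ∷ w) (begin
  toList (Vec.reverse y Vec.++ y) ++ F      ≡⟨ cong (_++ F) (toList-++ (Vec.reverse y) y) ⟩
  (toList (Vec.reverse y) ++ toList y) ++ F ≡⟨ ++-assoc (toList (Vec.reverse y)) (toList y) F ⟩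
  toList (Vec.reverse y) ++ R               ≡⟨ cong (_++ R) (toList-reverse y) ⟩
  List.reverse (toList y) ++ R              ≡⟨ ʳ++-defn (toList y) ⟨
  toList y ʳ++ R                            ∎))
  (sym (++-ʳ++ (toList y)))
  where
  F = false ∷ true ∷ []
  R = toList y ++ F

typeRep-mirror : ∀ {k} (y : Vec Bool k) →
                 Centred (centralBlock (toList y)) (typeRep (Vec.reverse y Vec.++ y))
typeRep-mirror y with centralBlock-decomposition (toList y)
... | t , B , split , block =
  subst₂ Centred (sym block)
         (cong blockLengths (sym (trans (binaryRep-mirror y) (cong (λ R → R ʳ++ R) split))))
         (centred-mirror t B)

reverse-++ : ∀ {a m} {A : Set a} (x y : Vec A m) →
             Vec.reverse (x Vec.++ y) ≡ Vec.reverse y Vec.++ Vec.reverse x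
reverse-++ x y = trans (sym (cast-is-id _ _)) (reverse-++-eqFree x y)

selfTwin-mirror : ∀ {k} (y : Vec Bool k) → SelfTwin (Vec.reverse y Vec.++ y)
selfTwin-mirror y =
  trans (reverse-++ (Vec.reverse y) y) (cong (Vec.reverse y Vec.++_) (reverse-involutive y))

selfTwin-++ : ∀ {k} (x y : Vec Bool k) → SelfTwin (x Vec.++ y) → x ≡ Vec.reverse y
selfTwin-++ x y twin =
  sym (++-injectiveˡ (Vec.reverse y) x (trans (sym (reverse-++ x y)) twin))

oddFreePivot : ∀ {m} → PGame m → ℕ
oddFreePivot = restrict oddFree? pivot

countedPivot : ∀ {m} → PGame m → ℕ
countedPivot = restrict selfTwin? oddFreePivot

pivotSum-countedPivot : ∀ m → pivotSum m ≡ sum (List.map countedPivot (allPGames m))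
pivotSum-countedPivot m =
  trans (sum-map-filter oddFree? pivot (filter selfTwin? (allPGames m)))
        (sum-map-filter selfTwin? oddFreePivot (allPGames m))

countedPivot-mirror : ∀ {k} (y : Vec Bool k) →
                      countedPivot (Vec.reverse y Vec.++ y) ≡ centralBlock (toList y)
countedPivot-mirror y = begin
  countedPivot c
    ≡⟨ restrict-accept selfTwin? oddFreePivot c (selfTwin-mirror y) ⟩
  oddFreePivot c
    ≡⟨ restrict-accept oddFree? pivot c (centred-dropLast-odd (typeRep-mirror y)) ⟩
  pivot c
    ≡⟨ centred-nth-half (typeRep-mirror y) ⟩
  centralBlock (toList y) ∎
  where
  c = Vec.reverse y Vec.++ y

countedPivot-unmirrored : ∀ {k} (x y : Vec Bool k) → x ≢ Vec.reverse y →
                          countedPivot (x Vec.++ y) ≡ 0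
countedPivot-unmirrored x y x≢ȳ =
  restrict-reject selfTwin? oddFreePivot (x Vec.++ y) (x≢ȳ ∘ selfTwin-++ x y)

pivotSum-double : ∀ k → pivotSum (k + k) ≡ 3 * 2 ^ k
pivotSum-double k = begin
  pivotSum (k + k)
    ≡⟨ pivotSum-countedPivot (k + k) ⟩
  sum (List.map countedPivot (allPGames (k + k)))
    ≡⟨ sum-map-allPGames (k + k) countedPivot ⟩
  sumVecs (k + k) countedPivot
    ≡⟨ sumVecs-++ k k countedPivot ⟩
  sumVecs k (λ x → sumVecs k (λ y → countedPivot (x Vec.++ y)))
    ≡⟨ sumVecs-swap k k _ ⟩
  sumVecs k (λ y → sumVecs k (λ x → countedPivot (x Vec.++ y)))
    ≡⟨ sumVecs-cong k (λ y → sumVecs-single k (Vec.reverse y) _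
                                 (λ x → countedPivot-unmirrored x y)) ⟩
  sumVecs k (λ y → countedPivot (Vec.reverse y Vec.++ y))
    ≡⟨ sumVecs-cong k countedPivot-mirror ⟩
  sumVecs k (centralBlock ∘ toList)
    ≡⟨ sumVecs-centralBlock k ⟩
  3 * 2 ^ k ∎

mainTheorem14 : (m : ℕ) → m % 2 ≡ 0 → pivotSum m ≡ 3 * 2 ^ (m / 2)
mainTheorem14 m m-even =
  subst (λ n → pivotSum n ≡ 3 * 2 ^ (m / 2)) (sym m≡half+half) (pivotSum-double (m / 2))
  where
  double : ∀ q → 0 + q * 2 ≡ q + q
  double = solve-∀
  m≡half+half : m ≡ m / 2 + m / 2
  m≡half+half = trans (m≡m%n+[m/n]*n m 2) (trans (cong (_+ m / 2 * 2) m-even) (double (m / 2)))
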